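{- Let $G = \{G_1, \ldots, G_n\}$ with $n \ge 1$. Assume that for every $j \ge 2$, the option $G_j = \{G_{j1}, \ldots, G_{jm_j}\}$ has some option $G_{j\ell}$ with $G_{j\ell} \equiv \{G_1\}$. Then $G \equiv \{G_1\}$.
   Context: Positions are defined recursively: $*L$ and $*R$ are terminal positions; if $G_1,\dots,G_n$ ($n\ge 1$) are positions, then $\{G_1,\dots,G_n\}$ is a position with options $G_1,\dots,G_n$ (so $\{G_1\}$ is the position whose only option is $G_1$). All positions have finite game trees. Play: Left and Right move alternately, each choosing any option of the current position; when a terminal position is reached, Left wins if it is $*L$ and Right wins if it is $*R$. Disjunctive sum: $*L + *L = *R + *R = *L$, $*L + *R = *R + *L = *R$; if at least one of $G,H$ is non-terminal, $G+H$ has options all $G'+H$ ($G'$ an option of $G$) and all $G+H'$ ($H'$ an option of $H$). Outcome classes: $\mathcal{L}$ (Left wins moving first or second), $\mathcal{R}$ (Right wins moving first or second), $\mathcal{N}$ (first player wins), $\mathcal{P}$ (second player wins); $o(G)$ denotes the outcome class. Equivalence: $G \equiv H$ iff $o(G+X) = o(H+X)$ for every position $X$. -}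

module Defs where

open import Data.Nat using (ℕ; zero; suc; _+_)
open import Data.Fin using (Fin; zero; suc; splitAt)
open import Data.Sum using (_⊎_; inj₁; inj₂)
open import Data.Bool using (Bool; true; false)
open import Data.Product using (_×_; _,_)
open import Relation.Binary.PropositionalEquality using (_≡_)

-- Positions: the terminals *L, *R, and {G_1,...,G_k} with k ≥ 1,
-- represented as  node n f  with the k = suc n options  f 0, ..., f n.
data Game : Set where
  *L : Game
  *R : Game
  node : (n : ℕ) → (Fin (suc n) → Game) → Game

data _OptionOf_ : Game → Game → Set where
  opt : ∀ {n} (f : Fin (suc n) → Game) (i : Fin (suc n)) → f i OptionOf node n f

⟨_⟩ : Game → Game
⟨ g ⟩ = node zero (λ _ → g)

-- For node + node the options are all G'+H (the first
-- suc m indices) followed by all G+H' (the next suc k indices).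
-- Implemented by recursion on G, with an inner recursion on H
-- (sumNode m f r H computes  node m f ⊕ H  where r i X = f i ⊕ X).
sumNode : (m : ℕ) → (Fin (suc m) → Game) → (Fin (suc m) → Game → Game) → Game → Game
sumNode m f r *L = node m (λ i → r i *L)
sumNode m f r *R = node m (λ i → r i *R)
sumNode m f r (node k h) = node (m + suc k) (λ i → pick (splitAt (suc m) i))
  where
  pick : Fin (suc m) ⊎ Fin (suc k) → Game
  pick (inj₁ i) = r i (node k h)
  pick (inj₂ j) = sumNode m f r (h j)

sumL : Game → Game → Game
sumL *L (node k h) = node k (λ j → sumL *L (h j))
sumL *R (node k h) = node k (λ j → sumL *R (h j))
sumL *L *L = *L
sumL *L *R = *R
sumL *R *L = *R
sumL *R *R = *L
sumL (node m f) H = sumNode m f (λ i → sumL (f i)) H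

infixl 6 _⊕_
_⊕_ : Game → Game → Game
_⊕_ = sumL

any : ∀ {n} → (Fin n → Bool) → Bool
any {zero} p = false
any {suc n} p with p zero
... | true = true
... | false = any (λ i → p (suc i))

all : ∀ {n} → (Fin n → Bool) → Bool
all {zero} p = true
all {suc n} p with p zero
... | true = all (λ i → p (suc i))
... | false = false

-- leftWins true G  : Left wins G when Left moves first
-- leftWins false G : Left wins G when Right moves first
leftWins : Bool → Game → Bool
leftWins _ *L = true
leftWins _ *R = false
leftWins true  (node n f) = any (λ i → leftWins false (f i))
leftWins false (node n f) = all (λ i → leftWins true (f i))

data Outcome : Set where
  𝓛 𝓡 𝓝 𝓟 : Outcome

o : Game → Outcome
o G with leftWins true G | leftWins false G
... | true  | true  = 𝓛
... | false | false = 𝓡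
... | true  | false = 𝓝
... | false | true  = 𝓟

_≡ᵍ_ : Game → Game → Set
G ≡ᵍ H = ∀ (X : Game) → o (G ⊕ X) ≡ o (H ⊕ X)

-- Let A be a node and let B have the options of A together with extra options Y,
-- each having an option H ≡ A; then B ≡ A (the theorem is the case A = {G₁}).
-- Compare B + X with A + X by induction on X.  Moves in X are matched by the
-- induction hypothesis and moves to A's options are available in both.  A move to
-- Y + X is answered by the opponent moving to H + X, which has the outcome of A + X;
-- so if Left wins B + X moving first via Y + X, she wins A + X moving first, and if
-- she wins A + X moving second, she survives Right's move to Y + X in B + X.
module Submission where

open import Defs
open import Data.Nat using (ℕ; suc; _+_)
open import Data.Fin using (Fin; zero; suc; splitAt; _↑ˡ_; _↑ʳ_)
open import Data.Fin.Properties using (splitAt-↑ˡ; splitAt-↑ʳ)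
open import Data.Bool using (Bool; true; false)
open import Data.Bool.Properties using (⇔→≡)
open import Data.Sum using (_⊎_; inj₁; inj₂)
open import Data.Product using (_×_; _,_; ∃-syntax)
open import Function.Bundles using (mk⇔)
open import Induction.WellFounded using (WellFounded; acc; module All)
open import Relation.Binary.PropositionalEquality
  using (_≡_; refl; sym; trans; cong; module ≡-Reasoning)
open import Relation.Nullary using (¬_)

any≡true⇒∃ : ∀ {n} (p : Fin n → Bool) → any p ≡ true → ∃[ i ] p i ≡ true
any≡true⇒∃ {suc n} p e with p zero in eq
... | true = zero , eq
... | false with any≡true⇒∃ (λ i → p (suc i)) e
...   | i , pi = suc i , pi

∃⇒any≡true : ∀ {n} (p : Fin n → Bool) i → p i ≡ true → any p ≡ true
∃⇒any≡true p zero e rewrite e = refl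
∃⇒any≡true p (suc i) e with p zero
... | true = refl
... | false = ∃⇒any≡true (λ j → p (suc j)) i e

all≡true⇒∀ : ∀ {n} (p : Fin n → Bool) → all p ≡ true → ∀ i → p i ≡ true
all≡true⇒∀ {suc n} p e i with p zero in eq
all≡true⇒∀ {suc n} p e zero    | true = eq
all≡true⇒∀ {suc n} p e (suc i) | true = all≡true⇒∀ (λ j → p (suc j)) e i

∀⇒all≡true : ∀ {n} (p : Fin n → Bool) → (∀ i → p i ≡ true) → all p ≡ true
∀⇒all≡true {0} p h = refl
∀⇒all≡true {suc n} p h rewrite h zero = ∀⇒all≡true (λ j → p (suc j)) (λ i → h (suc i))

optionOf-wellFounded : WellFounded _OptionOf_
optionOf-wellFounded *L = acc λ ()
optionOf-wellFounded *R = acc λ ()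
optionOf-wellFounded (node n f) =
  acc λ { (opt .f i) → optionOf-wellFounded (f i) }

data NonTerminal : Game → Set where
  node : ∀ {n} {f : Fin (suc n) → Game} → NonTerminal (node n f)

LeftWins : Bool → Game → Set
LeftWins b G = leftWins b G ≡ true

winsFirst⇒winningOption : ∀ {G} → NonTerminal G → LeftWins true G →
  ∃[ Y ] (Y OptionOf G × LeftWins false Y)
winsFirst⇒winningOption (node {f = f}) w with any≡true⇒∃ (λ i → leftWins false (f i)) w
... | i , wi = f i , opt f i , wi

winningOption⇒winsFirst : ∀ {G Y} → Y OptionOf G → LeftWins false Y → LeftWins true G
winningOption⇒winsFirst (opt f i) = ∃⇒any≡true (λ j → leftWins false (f j)) i

winsSecond⇒optionsWinFirst : ∀ {G Y} → LeftWins false G → Y OptionOf G → LeftWins true Y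
winsSecond⇒optionsWinFirst w (opt f i) = all≡true⇒∀ (λ j → leftWins true (f j)) w i

optionsWinFirst⇒winsSecond : ∀ {G} → NonTerminal G →
  (∀ {Y} → Y OptionOf G → LeftWins true Y) → LeftWins false G
optionsWinFirst⇒winsSecond (node {f = f}) h =
  ∀⇒all≡true (λ j → leftWins true (f j)) (λ i → h (opt f i))

data SumOption (G X : Game) : Game → Set where
  inˡ : ∀ {G'} → G' OptionOf G → SumOption G X (G' ⊕ X)
  inʳ : ∀ {X'} → X' OptionOf X → SumOption G X (G ⊕ X')

sumOption⁻ : ∀ G X {Y} → Y OptionOf (G ⊕ X) → SumOption G X Y
sumOption⁻ *L (node k h) (opt _ j) = inʳ (opt h j)
sumOption⁻ *R (node k h) (opt _ j) = inʳ (opt h j)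
sumOption⁻ (node m f) *L (opt _ i) = inˡ (opt f i)
sumOption⁻ (node m f) *R (opt _ i) = inˡ (opt f i)
sumOption⁻ (node m f) (node k h) (opt _ q) with splitAt (suc m) q
... | inj₁ i = inˡ (opt f i)
... | inj₂ j = inʳ (opt h j)

-- The option family of a sum of two nodes is local to sumNode, so it is abstracted as F.
⊕-option-↑ˡ : ∀ {m k} (f : Fin (suc m) → Game) (h : Fin (suc k) → Game) {F} →
  node m f ⊕ node k h ≡ node (m + suc k) F → ∀ i → F (i ↑ˡ suc k) ≡ f i ⊕ node k h
⊕-option-↑ˡ {m} {k} f h refl i rewrite splitAt-↑ˡ (suc m) i (suc k) = refl

⊕-option-↑ʳ : ∀ {m k} (f : Fin (suc m) → Game) (h : Fin (suc k) → Game) {F} →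
  node m f ⊕ node k h ≡ node (m + suc k) F → ∀ j → F (suc m ↑ʳ j) ≡ node m f ⊕ h j
⊕-option-↑ʳ {m} {k} f h refl j rewrite splitAt-↑ʳ (suc m) (suc k) j = refl

optionAt : ∀ {n} {F : Fin (suc n) → Game} {Y} i → F i ≡ Y → Y OptionOf node n F
optionAt i refl = opt _ i

sumOption⁺ : ∀ G X {Y} → SumOption G X Y → Y OptionOf (G ⊕ X)
sumOption⁺ (node m f) *L (inˡ (opt f i)) = opt _ i
sumOption⁺ (node m f) *R (inˡ (opt f i)) = opt _ i
sumOption⁺ (node m f) (node k h) (inˡ (opt f i)) =
  optionAt (i ↑ˡ suc k) (⊕-option-↑ˡ f h refl i)
sumOption⁺ *L (node k h) (inʳ (opt h j)) = opt _ j
sumOption⁺ *R (node k h) (inʳ (opt h j)) = opt _ j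
sumOption⁺ (node m f) (node k h) (inʳ (opt h j)) =
  optionAt (suc m ↑ʳ j) (⊕-option-↑ʳ f h refl j)

⊕-nonTerminal : ∀ {G} → NonTerminal G → ∀ X → NonTerminal (G ⊕ X)
⊕-nonTerminal node *L = node
⊕-nonTerminal node *R = node
⊕-nonTerminal node (node k h) = node

SameWinner : Game → Game → Set
SameWinner G H = ∀ b → leftWins b G ≡ leftWins b H

sameWinner⇒o≡ : ∀ G H → SameWinner G H → o G ≡ o H
sameWinner⇒o≡ G H s rewrite s true | s false = refl

leftWinsIn : Bool → Outcome → Bool
leftWinsIn true  𝓛 = true
leftWinsIn true  𝓝 = true
leftWinsIn false 𝓛 = true
leftWinsIn false 𝓟 = true
leftWinsIn _     _ = false

leftWinsIn-o : ∀ b G → leftWinsIn b (o G) ≡ leftWins b G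
leftWinsIn-o true G with leftWins true G | leftWins false G
... | true  | true  = refl
... | true  | false = refl
... | false | true  = refl
... | false | false = refl
leftWinsIn-o false G with leftWins true G | leftWins false G
... | true  | true  = refl
... | true  | false = refl
... | false | true  = refl
... | false | false = refl

o≡⇒sameWinner : ∀ G H → o G ≡ o H → SameWinner G H
o≡⇒sameWinner G H e b = begin
  leftWins b G        ≡⟨ sym (leftWinsIn-o b G) ⟩
  leftWinsIn b (o G)  ≡⟨ cong (leftWinsIn b) e ⟩
  leftWinsIn b (o H)  ≡⟨ leftWinsIn-o b H ⟩
  leftWins b H        ∎
  where open ≡-Reasoning

winsSecond⇒winsFirst-≡ᵍ-option : ∀ {H Y} K X → H OptionOf Y → H ≡ᵍ K →
  LeftWins false (Y ⊕ X) → LeftWins true (K ⊕ X)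
winsSecond⇒winsFirst-≡ᵍ-option {H} {Y} K X H∈Y H≡K w =
  trans (sym (o≡⇒sameWinner (H ⊕ X) (K ⊕ X) (H≡K X) true))
        (winsSecond⇒optionsWinFirst w (sumOption⁺ Y X (inˡ H∈Y)))

winsSecond-≡ᵍ-option⇒winsFirst : ∀ {H Y} K X → H OptionOf Y → H ≡ᵍ K →
  LeftWins false (K ⊕ X) → LeftWins true (Y ⊕ X)
winsSecond-≡ᵍ-option⇒winsFirst {H} {Y} K X H∈Y H≡K w =
  winningOption⇒winsFirst (sumOption⁺ Y X (inˡ H∈Y))
                          (trans (o≡⇒sameWinner (H ⊕ X) (K ⊕ X) (H≡K X) false) w)

module _ {m n} {f : Fin (suc m) → Game} {g : Fin (suc n) → Game}
  (A⊆B : ∀ {Y} → Y OptionOf node m f → Y OptionOf node n g)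
  (B⊆A+reverting : ∀ {Y} → Y OptionOf node n g →
    Y OptionOf node m f ⊎ ∃[ H ] (H OptionOf Y × H ≡ᵍ node m f))
  where

  private
    A B : Game
    A = node m f
    B = node n g

    A⊕-nonTerminal : ∀ X → NonTerminal (A ⊕ X)
    A⊕-nonTerminal = ⊕-nonTerminal {A} node

    B⊕-nonTerminal : ∀ X → NonTerminal (B ⊕ X)
    B⊕-nonTerminal = ⊕-nonTerminal {B} node

    SameWinnerOnOptions : Game → Set
    SameWinnerOnOptions X = ∀ {X'} → X' OptionOf X → SameWinner (B ⊕ X') (A ⊕ X')

  module _ {X} (ih : SameWinnerOnOptions X) where

    firstB⇒firstA : LeftWins true (B ⊕ X) → LeftWins true (A ⊕ X)
    firstB⇒firstA w with winsFirst⇒winningOption (B⊕-nonTerminal X) w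
    ... | Y , Y∈ , wY with sumOption⁻ B X Y∈
    ...   | inʳ X'∈X =
              winningOption⇒winsFirst (sumOption⁺ A X (inʳ X'∈X)) (trans (sym (ih X'∈X false)) wY)
    ...   | inˡ G'∈B with B⊆A+reverting G'∈B
    ...     | inj₁ G'∈A = winningOption⇒winsFirst (sumOption⁺ A X (inˡ G'∈A)) wY
    ...     | inj₂ (_ , H∈G' , H≡A) = winsSecond⇒winsFirst-≡ᵍ-option A X H∈G' H≡A wY

    firstA⇒firstB : LeftWins true (A ⊕ X) → LeftWins true (B ⊕ X)
    firstA⇒firstB w with winsFirst⇒winningOption (A⊕-nonTerminal X) w
    ... | Y , Y∈ , wY with sumOption⁻ A X Y∈
    ...   | inˡ G'∈A = winningOption⇒winsFirst (sumOption⁺ B X (inˡ (A⊆B G'∈A))) wY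
    ...   | inʳ X'∈X =
              winningOption⇒winsFirst (sumOption⁺ B X (inʳ X'∈X)) (trans (ih X'∈X false) wY)

    secondB⇒secondA : LeftWins false (B ⊕ X) → LeftWins false (A ⊕ X)
    secondB⇒secondA w =
      optionsWinFirst⇒winsSecond (A⊕-nonTerminal X) λ Y∈ → reply (sumOption⁻ A X Y∈)
      where
      reply : ∀ {Y} → SumOption A X Y → LeftWins true Y
      reply (inˡ G'∈A) = winsSecond⇒optionsWinFirst w (sumOption⁺ B X (inˡ (A⊆B G'∈A)))
      reply (inʳ X'∈X) =
        trans (sym (ih X'∈X true)) (winsSecond⇒optionsWinFirst w (sumOption⁺ B X (inʳ X'∈X)))

    secondA⇒secondB : LeftWins false (A ⊕ X) → LeftWins false (B ⊕ X)
    secondA⇒secondB w =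
      optionsWinFirst⇒winsSecond (B⊕-nonTerminal X) λ Y∈ → reply (sumOption⁻ B X Y∈)
      where
      reply : ∀ {Y} → SumOption B X Y → LeftWins true Y
      reply (inʳ X'∈X) =
        trans (ih X'∈X true) (winsSecond⇒optionsWinFirst w (sumOption⁺ A X (inʳ X'∈X)))
      reply (inˡ G'∈B) with B⊆A+reverting G'∈B
      ... | inj₁ G'∈A = winsSecond⇒optionsWinFirst w (sumOption⁺ A X (inˡ G'∈A))
      ... | inj₂ (_ , H∈G' , H≡A) = winsSecond-≡ᵍ-option⇒winsFirst A X H∈G' H≡A w

    sameWinner-⊕-from-options : SameWinner (B ⊕ X) (A ⊕ X)
    sameWinner-⊕-from-options true  = ⇔→≡ (mk⇔ firstB⇒firstA firstA⇒firstB)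
    sameWinner-⊕-from-options false = ⇔→≡ (mk⇔ secondB⇒secondA secondA⇒secondB)

  sameWinner-⊕ : ∀ X → SameWinner (B ⊕ X) (A ⊕ X)
  sameWinner-⊕ = All.wfRec optionOf-wellFounded _ _ (λ _ → sameWinner-⊕-from-options)

  ≡ᵍ-add-reverting-options : node n g ≡ᵍ node m f
  ≡ᵍ-add-reverting-options X = sameWinner⇒o≡ (B ⊕ X) (A ⊕ X) (sameWinner-⊕ X)

theorem3p10 : (n : ℕ) (G : Fin (suc n) → Game) →
    (∀ (j : Fin (suc n)) → ¬ (j ≡ zero) →
      ∃[ H ] ((H OptionOf G j) × (H ≡ᵍ ⟨ G zero ⟩))) →
    node n G ≡ᵍ ⟨ G zero ⟩
theorem3p10 n G reverting = ≡ᵍ-add-reverting-options singleton⊆G G⊆singleton+reverting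
  where
  singleton⊆G : ∀ {Y} → Y OptionOf ⟨ G zero ⟩ → Y OptionOf node n G
  singleton⊆G (opt _ zero) = opt G zero

  G⊆singleton+reverting : ∀ {Y} → Y OptionOf node n G →
    Y OptionOf ⟨ G zero ⟩ ⊎ ∃[ H ] (H OptionOf Y × H ≡ᵍ ⟨ G zero ⟩)
  G⊆singleton+reverting (opt _ zero)    = inj₁ (opt _ zero)
  G⊆singleton+reverting (opt _ (suc j)) = inj₂ (reverting (suc j) λ ())
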